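{- The successor and co-successor functions are bijections on the set $\mathsf{Live}(\mathcal{S})$ of live entries of any scroll $\mathcal{S}$.
   Context: Let $n\ge2$ and $\mathcal{C}_n$ the cycle graph on $\mathbb{Z}_n=\{1,\dots,n\}$ with edges $\{i,i+1\}$ (mod $n$). Independent sets are binary vectors $x\in\{0,1\}^n$ with no two cyclically adjacent $1$s. The toggle $\tau_k$ changes $x_k$ from $1$ to $0$, from $0$ to $1$ if the result is independent, otherwise does nothing; $\tau=\tau_n\circ\cdots\circ\tau_1$, $x^{(i)}=\tau^i(x)$ for $i\in\mathbb{Z}$. The scroll $\mathcal{S}$ of $x$ is the array $X_{i,j}$ ($i\in\mathbb{Z}$, $j\in\{1,\dots,n\}$) with $X_{i,j}$ the $j$-th entry of $x^{(i)}$, with convention $X_{i,j+n}=X_{i+1,j}$; $\mathsf{Live}(\mathcal{S})$ is the set of positions with value $1$. The successor $s$ sends a live $(i,j)$ to the unique element of $\{(i,j+2),(i+1,j+1)\}\cap\mathsf{Live}(\mathcal{S})$, and the co-successor $c$ sends it to the unique element of $\{(i+2,j-2),(i+2,j-1)\}\cap\mathsf{Live}(\mathcal{S})$ (these sets have exactly one element). -}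

module Defs where

open import Data.Bool using (Bool; true; false; if_then_else_; not; _∧_)
open import Data.Nat as ℕ using (ℕ; zero; suc; NonZero)
import Data.Nat.DivMod as ℕDM
open import Data.Integer as ℤ using (ℤ; +_; -[1+_]; _%ℕ_; _/ℕ_)
open import Data.Integer.DivMod using (n%ℕd<d)
open import Data.Fin using (Fin; toℕ; fromℕ<)
open import Data.Product using (Σ; _×_; _,_; proj₁)
open import Relation.Binary.PropositionalEquality using (_≡_; _≢_)
open import Relation.Nullary using (¬_)
open import Data.Fin using (_≟_)
open import Relation.Nullary.Decidable using (does)

-- Vertices of the cycle C_n are Fin n; vertex k : Fin n is the paper's vertex (toℕ k + 1).
-- Configurations (binary vectors of length n).
Config : ℕ → Set
Config n = Fin n → Bool

nextV : ∀ {n} .{{_ : NonZero n}} → Fin n → Fin n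
nextV {n} k = fromℕ< (ℕDM.m%n<n (suc (toℕ k)) n)

prevV : ∀ {n} .{{_ : NonZero n}} → Fin n → Fin n
prevV {n} k = fromℕ< (ℕDM.m%n<n (toℕ k ℕ.+ ℕ.pred n) n)

Independent : ∀ {n} .{{_ : NonZero n}} → Config n → Set
Independent {n} x = ∀ (k : Fin n) → ¬ (x k ≡ true × x (nextV k) ≡ true)

toggle : ∀ {n} .{{_ : NonZero n}} → Fin n → Config n → Config n
toggle {n} k x l =
  if does (l ≟ k)
  then (if x k then false else not (x (prevV k)) ∧ not (x (nextV k)))
  else x l

-- toggles f m x: apply the toggle at vertex (f (m-1) mod n) first, then f (m-2), ..., finally f 0
toggles : ∀ {n} .{{_ : NonZero n}} → (ℕ → ℕ) → ℕ → Config n → Config n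
toggles f zero x = x
toggles {n} f (suc m) x = toggles f m (toggle (fromℕ< (ℕDM.m%n<n (f m) n)) x)

-- τ = τ_n ∘ ⋯ ∘ τ_1 : first τ_1 (vertex index 0), last τ_n (index n-1)
tau : ∀ {n} .{{_ : NonZero n}} → Config n → Config n
tau {n} = toggles (λ m → ℕ.pred n ℕ.∸ m) n

-- τ⁻¹ = τ_1 ∘ ⋯ ∘ τ_n : first τ_n, last τ_1 (each toggle is an involution on independent sets)
tauInv : ∀ {n} .{{_ : NonZero n}} → Config n → Config n
tauInv {n} = toggles (λ m → m) n

iterN : ∀ {A : Set} → (A → A) → ℕ → A → A
iterN f zero a = a
iterN f (suc m) a = f (iterN f m a)

orbit : ∀ {n} .{{_ : NonZero n}} → Config n → ℤ → Config n
orbit x (+ m) = iterN tau m x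
orbit x -[1+ m ] = iterN tauInv (suc m) x

-- Positions of the scroll: (i , k) with i ∈ ℤ the row and k : Fin n the column
-- (paper's column j = toℕ k + 1).
Pos : ℕ → Set
Pos n = ℤ × Fin n

-- normalise an arbitrary (i , j) with i, j ∈ ℤ (j a 1-based column) using X_{i,j+n} = X_{i+1,j}
norm : ∀ (n : ℕ) .{{_ : NonZero n}} → ℤ → ℤ → Pos n
norm n i j = (L /ℕ n , fromℕ< (n%ℕd<d L n))
  where L = i ℤ.* + n ℤ.+ (j ℤ.- + 1)

val : ∀ {n} .{{_ : NonZero n}} → Config n → Pos n → Bool
val x (i , k) = orbit x i k

X : ∀ {n} .{{_ : NonZero n}} → Config n → ℤ → ℤ → Bool
X {n} x i j = val x (norm n i j)

Live : ∀ (n : ℕ) .{{_ : NonZero n}} → Config n → Set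
Live n x = Σ (Pos n) (λ p → val x p ≡ true)

col : ∀ {n} → Fin n → ℤ
col k = + suc (toℕ k)

succ : ∀ (n : ℕ) .{{_ : NonZero n}} → Config n → Pos n → Pos n
succ n x (i , k) =
  if val x (norm n i (col k ℤ.+ + 2)) then norm n i (col k ℤ.+ + 2)
  else norm n (i ℤ.+ + 1) (col k ℤ.+ + 1)

cosucc : ∀ (n : ℕ) .{{_ : NonZero n}} → Config n → Pos n → Pos n
cosucc n x (i , k) =
  if val x (norm n (i ℤ.+ + 2) (col k ℤ.- + 2)) then norm n (i ℤ.+ + 2) (col k ℤ.- + 2)
  else norm n (i ℤ.+ + 2) (col k ℤ.- + 1)

module Submission where

-- Read row by row, the scroll is a single bi-infinite 0/1 sequence a, position (i , k) being entry
-- L = i n + k.  When τ toggles vertex k of row i, its left neighbour already carries its new value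
-- and its right neighbour its old one; thanks to the wrap-around X_{i,j+n} = X_{i+1,j} these are
-- entries L + n - 1 and L + 1 also for the first and the last vertex.  Hence
--     a (L + n) = 1  iff  a L = a (L + n - 1) = a (L + 1) = 0,
-- while the successor becomes L ↦ L + 2 or L + n + 1 and the co-successor L ↦ L + 2n - 2 or
-- L + 2n - 1.  This recurrence alone makes both maps send live entries to live entries, be
-- injective on them (two live entries are never at distance 1, n - 1 or n) and reach every live
-- entry M: the toggle that switched M on saw M - 1 and M - n + 1 off, and the recurrence at
-- those entries exhibits a live preimage.

open import Algebra.Bundles using (AbelianGroup)
open import Axiom.UniquenessOfIdentityProofs using (module Decidable⇒UIP)
open import Data.Bool using (Bool; true; false; not; _∧_; if_then_else_)
import Data.Bool as Bool
open import Data.Bool.Properties using (if-float)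
open import Data.Empty using (⊥; ⊥-elim)
open import Data.Fin using (Fin; toℕ; fromℕ<; _≟_)
import Data.Fin.Properties as Fin
open import Data.Integer as ℤ using (ℤ; +_; -_; -[1+_]; +<+; 1ℤ; _+_; _-_; _*_; _/ℕ_; _%ℕ_)
open import Data.Integer.DivMod using (n%ℕd<d; a≡a%ℕn+[a/ℕn]*n; [n/ℕd]*d≤n; n<s[n/ℕd]*d)
import Data.Integer.Properties as ℤ
open import Data.Integer.Tactic.RingSolver using (solve-∀)
open import Data.Nat as ℕ using (ℕ; zero; suc; NonZero; _∸_; _%_; _<_; _≤_; z≤n; s≤s; s≤s⁻¹)
open import Data.Nat.DivMod using (m%n<n; m<n⇒m%n≡m; %-congˡ; n%n≡0; [m+n]%n≡m%n)
import Data.Nat.Properties as ℕ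
open import Data.Product using (Σ; _×_; _,_; proj₁; proj₂)
open import Data.Sum using (_⊎_; inj₁; inj₂)
open import Function.Definitions using (Bijective; Injective; Surjective)
open import Relation.Binary.PropositionalEquality
  using (_≡_; _≢_; refl; sym; trans; cong; cong₂; subst; subst₂; module ≡-Reasoning)
open import Relation.Nullary using (Dec; yes; no)
open import Relation.Nullary.Decidable using (dec-true; dec-false)

open import Defs
open import Algebra.Properties.Group (AbelianGroup.group ℤ.+-0-abelianGroup) using (∙-cancelʳ)

toggleRule : Bool → Bool → Bool → Bool
toggleRule b p q = if b then false else not p ∧ not q

toggleRule-cong : ∀ {b b' p p' q q'} → b ≡ b' → p ≡ p' → q ≡ q' →
  toggleRule b p q ≡ toggleRule b' p' q'
toggleRule-cong refl refl refl = refl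

toggleRule≡true⇒ : ∀ b p q → toggleRule b p q ≡ true → b ≡ false × p ≡ false × q ≡ false
toggleRule≡true⇒ false false false _ = refl , refl , refl
toggleRule≡true⇒ false false true ()
toggleRule≡true⇒ false true _ ()
toggleRule≡true⇒ true _ _ ()

toggleRule≡true⇐ : ∀ {b p q} → b ≡ false → p ≡ false → q ≡ false → toggleRule b p q ≡ true
toggleRule≡true⇐ refl refl refl = refl

toggleRule≡false⇒ : ∀ b p q → toggleRule b p q ≡ false → b ≡ true ⊎ p ≡ true ⊎ q ≡ true
toggleRule≡false⇒ true _ _ _ = inj₁ refl
toggleRule≡false⇒ false true _ _ = inj₂ (inj₁ refl)
toggleRule≡false⇒ false false true _ = inj₂ (inj₂ refl)
toggleRule≡false⇒ false false false ()

toggleRule-involutive : ∀ b p q → (b ≡ true → p ≡ false × q ≡ false) →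
  toggleRule (toggleRule b p q) p q ≡ b
toggleRule-involutive true p q dead with dead refl
... | refl , refl = refl
toggleRule-involutive false false false _ = refl
toggleRule-involutive false false true _ = refl
toggleRule-involutive false true _ _ = refl

true-and-false : ∀ {b} → b ≡ true → b ≡ false → ⊥
true-and-false refl ()

+-cancelʳ : ∀ k {i j} → i + k ≡ j + k → i ≡ j
+-cancelʳ k {i} {j} = ∙-cancelʳ k i j

record PermutesLive {A : Set} (live : A → Bool) (g : A → A) : Set where
  field
    preserves-live : ∀ {p} → live p ≡ true → live (g p) ≡ true
    injective-on-live : ∀ {p q} → live p ≡ true → live q ≡ true → g p ≡ g q → p ≡ q
    surjective-on-live : ∀ {q} → live q ≡ true → Σ A λ p → live p ≡ true × g p ≡ q

permutesLive-restricts : ∀ {A : Set} {live : A → Bool} {g : A → A} → PermutesLive live g →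
  Σ (Σ A (λ p → live p ≡ true) → Σ A (λ p → live p ≡ true)) λ f →
    (∀ q → proj₁ (f q) ≡ g (proj₁ q)) × Bijective _≡_ _≡_ f
permutesLive-restricts {A} {live} {g} perm = f , (λ _ → refl) , injective , surjective
  where
  open PermutesLive perm
  Live' = Σ A (λ p → live p ≡ true)

  ≡-live : ∀ {p q} {lp : live p ≡ true} {lq : live q ≡ true} → p ≡ q →
    _≡_ {A = Live'} (p , lp) (q , lq)
  ≡-live {lp = lp} {lq} refl = cong (_ ,_) (Decidable⇒UIP.≡-irrelevant Bool._≟_ lp lq)

  f : Live' → Live'
  f (p , lp) = g p , preserves-live lp

  injective : Injective _≡_ _≡_ f
  injective {p , lp} {q , lq} fp≡fq = ≡-live (injective-on-live lp lq (cong proj₁ fp≡fq))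

  surjective : Surjective _≡_ _≡_ f
  surjective (q , lq) with surjective-on-live lq
  ... | p , lp , gp≡q = (p , lp) , λ { refl → ≡-live gp≡q }

permutesLive-transport : ∀ {A B : Set} {live : B → Bool} (to : A → B) (from : B → A) →
  (∀ b → to (from b) ≡ b) → (∀ x → from (to x) ≡ x) →
  ∀ {f : A → A} {g : B → B} → (∀ b → g b ≡ to (f (from b))) →
  PermutesLive (λ x → live (to x)) f → PermutesLive live g
permutesLive-transport {A} {B} {live} to from to-from from-to {f} {g} g≡ perm = record
  { preserves-live = preserves
  ; injective-on-live = injective
  ; surjective-on-live = surjective
  }
  where
  open PermutesLive perm
  open ≡-Reasoning

  live-from : ∀ {b} → live b ≡ true → live (to (from b)) ≡ true
  live-from {b} lb = subst (λ c → live c ≡ true) (sym (to-from b)) lb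

  preserves : ∀ {b} → live b ≡ true → live (g b) ≡ true
  preserves {b} lb = subst (λ c → live c ≡ true) (sym (g≡ b)) (preserves-live (live-from lb))

  injective : ∀ {b b'} → live b ≡ true → live b' ≡ true → g b ≡ g b' → b ≡ b'
  injective {b} {b'} lb lb' gb≡gb' = begin
    b                ≡⟨ to-from b ⟨
    to (from b)      ≡⟨ cong to (injective-on-live (live-from lb) (live-from lb') f-from≡) ⟩
    to (from b')     ≡⟨ to-from b' ⟩
    b'               ∎
    where
    f-from≡ : f (from b) ≡ f (from b')
    f-from≡ = begin
      f (from b)             ≡⟨ from-to _ ⟨
      from (to (f (from b))) ≡⟨ cong from (trans (sym (g≡ b)) (trans gb≡gb' (g≡ b'))) ⟩
      from (to (f (from b'))) ≡⟨ from-to _ ⟩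
      f (from b')            ∎

  surjective : ∀ {b} → live b ≡ true → Σ B λ c → live c ≡ true × g c ≡ b
  surjective {b} lb with surjective-on-live (live-from lb)
  ... | x , lx , fx≡from-b = to x , lx , (begin
    g (to x)           ≡⟨ g≡ (to x) ⟩
    to (f (from (to x))) ≡⟨ cong (λ y → to (f y)) (from-to x) ⟩
    to (f x)           ≡⟨ cong to fx≡from-b ⟩
    to (from b)        ≡⟨ to-from b ⟩
    b                  ∎)

module ToggleRecurrence (a : ℤ → Bool) (n : ℤ)
  (recurrence : ∀ L → a (L + n) ≡ toggleRule (a L) (a (L + n - 1ℤ)) (a (L + 1ℤ))) where

  recurrence-at : ∀ L {A B C} → A ≡ L + n → B ≡ L + n - 1ℤ → C ≡ L + 1ℤ →
    a A ≡ toggleRule (a L) (a B) (a C)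
  recurrence-at L refl refl refl = recurrence L

  live⇒dead-above : ∀ {M} → a M ≡ true →
    a (M - n) ≡ false × a (M - 1ℤ) ≡ false × a (M - n + 1ℤ) ≡ false
  live⇒dead-above {M} live =
    toggleRule≡true⇒ _ _ _ (trans (sym (recurrence-at (M - n) (eq₁ M n) (eq₂ M n) refl)) live)
    where
    eq₁ : ∀ M n → M ≡ M - n + n
    eq₁ = solve-∀
    eq₂ : ∀ M n → M - 1ℤ ≡ M - n + n - 1ℤ
    eq₂ = solve-∀

  live⇒dead-below : ∀ {L} → a L ≡ true → a (L + n) ≡ false
  live⇒dead-below {L} live rewrite recurrence L | live = refl

  live⇒dead-right : ∀ {L} → a L ≡ true → a (L + 1ℤ) ≡ false
  live⇒dead-right {L} live with a (L + 1ℤ) in right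
  ... | false = refl
  ... | true = ⊥-elim (true-and-false live (subst (λ M → a M ≡ false) (eq L) left-dead))
    where
    eq : ∀ L → L + 1ℤ - 1ℤ ≡ L
    eq = solve-∀
    left-dead = proj₁ (proj₂ (live⇒dead-above right))

  live⇒dead-below-left : ∀ {L} → a L ≡ true → a (L + n - 1ℤ) ≡ false
  live⇒dead-below-left {L} live with a (L + n - 1ℤ) in below-left
  ... | false = refl
  ... | true = ⊥-elim (true-and-false live (subst (λ M → a M ≡ false) (eq L n) right-dead))
    where
    eq : ∀ L n → L + n - 1ℤ - n + 1ℤ ≡ L
    eq = solve-∀
    right-dead = proj₂ (proj₂ (live⇒dead-above below-left))

  +2≡+n+1⇒ : ∀ L L' → L + + 2 ≡ L' + n + 1ℤ → L ≡ L' + n - 1ℤ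
  +2≡+n+1⇒ L L' eq = +-cancelʳ (+ 2) (trans eq (shift L' n))
    where
    shift : ∀ L' n → L' + n + 1ℤ ≡ L' + n - 1ℤ + + 2
    shift = solve-∀

  +2n-2≡+2n-1⇒ : ∀ L L' → L + n + n - + 2 ≡ L' + n + n - 1ℤ → L ≡ L' + 1ℤ
  +2n-2≡+2n-1⇒ L L' eq = +-cancelʳ (n + n - + 2) (trans (shift₁ L n) (trans eq (shift₂ L' n)))
    where
    shift₁ : ∀ L n → L + (n + n - + 2) ≡ L + n + n - + 2
    shift₁ = solve-∀
    shift₂ : ∀ L' n → L' + n + n - 1ℤ ≡ L' + 1ℤ + (n + n - + 2)
    shift₂ = solve-∀

  successor : ℤ → ℤ
  successor L = if a (L + + 2) then L + + 2 else L + n + 1ℤ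

  successor-of-live : ∀ L → a (L + + 2) ≡ true → successor L ≡ L + + 2
  successor-of-live L live rewrite live = refl

  successor-of-dead : ∀ L → a (L + + 2) ≡ false → successor L ≡ L + n + 1ℤ
  successor-of-dead L dead rewrite dead = refl

  successor-preserves-live : ∀ {L} → a L ≡ true → a (successor L) ≡ true
  successor-preserves-live {L} live with a (L + + 2) in right₂
  ... | true = right₂
  ... | false = trans (recurrence-at (L + 1ℤ) (eq₁ L n) (eq₂ L n) (eq₃ L))
                      (toggleRule≡true⇐ (live⇒dead-right live) (live⇒dead-below live) right₂)
    where
    eq₁ : ∀ L n → L + n + 1ℤ ≡ L + 1ℤ + n
    eq₁ = solve-∀
    eq₂ : ∀ L n → L + n ≡ L + 1ℤ + n - 1ℤ
    eq₂ = solve-∀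
    eq₃ : ∀ L → L + + 2 ≡ L + 1ℤ + 1ℤ
    eq₃ = solve-∀

  successor-injective-on-live : ∀ {L L'} → a L ≡ true → a L' ≡ true →
    successor L ≡ successor L' → L ≡ L'
  successor-injective-on-live {L} {L'} live live' eq with a (L + + 2) | a (L' + + 2)
  ... | true | true = +-cancelʳ (+ 2) eq
  ... | false | false = +-cancelʳ n (+-cancelʳ 1ℤ eq)
  ... | true | false = ⊥-elim (true-and-false (subst (λ M → a M ≡ true) (+2≡+n+1⇒ L L' eq) live)
                                                (live⇒dead-below-left {L'} live'))
  ... | false | true = ⊥-elim (true-and-false (subst (λ M → a M ≡ true) (+2≡+n+1⇒ L' L (sym eq)) live')
                                                (live⇒dead-below-left {L} live))

  -- M kills M - 1, so by the recurrence one of M - 1 - n, M - 2 is live (M - n is dead as well).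
  successor-surjective-on-live : ∀ {M} → a M ≡ true → Σ ℤ λ L → a L ≡ true × successor L ≡ M
  successor-surjective-on-live {M} live = preimage (toggleRule≡false⇒ _ _ _ left-rule)
    where
    above-dead = live⇒dead-above live
    eq₁ : ∀ M n → M - 1ℤ ≡ M - 1ℤ - n + n
    eq₁ = solve-∀
    eq₂ : ∀ M n → M - + 2 ≡ M - 1ℤ - n + n - 1ℤ
    eq₂ = solve-∀
    eq₃ : ∀ M n → M - n ≡ M - 1ℤ - n + 1ℤ
    eq₃ = solve-∀
    eq₄ : ∀ M n → M - n + 1ℤ ≡ M - 1ℤ - n + + 2
    eq₄ = solve-∀
    eq₅ : ∀ M n → M - 1ℤ - n + n + 1ℤ ≡ M
    eq₅ = solve-∀
    eq₆ : ∀ M → M - + 2 + + 2 ≡ M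
    eq₆ = solve-∀
    left-rule : toggleRule (a (M - 1ℤ - n)) (a (M - + 2)) (a (M - n)) ≡ false
    left-rule = trans (sym (recurrence-at (M - 1ℤ - n) (eq₁ M n) (eq₂ M n) (eq₃ M n)))
                      (proj₁ (proj₂ above-dead))
    preimage : a (M - 1ℤ - n) ≡ true ⊎ a (M - + 2) ≡ true ⊎ a (M - n) ≡ true →
      Σ ℤ λ L → a L ≡ true × successor L ≡ M
    preimage (inj₁ up-left) = M - 1ℤ - n , up-left ,
      trans (successor-of-dead (M - 1ℤ - n)
               (subst (λ K → a K ≡ false) (eq₄ M n) (proj₂ (proj₂ above-dead))))
            (eq₅ M n)
    preimage (inj₂ (inj₁ left₂)) = M - + 2 , left₂ ,
      trans (successor-of-live (M - + 2) (subst (λ K → a K ≡ true) (sym (eq₆ M)) live)) (eq₆ M)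
    preimage (inj₂ (inj₂ up)) = ⊥-elim (true-and-false up (proj₁ above-dead))

  successor-permutesLive : PermutesLive a successor
  successor-permutesLive = record
    { preserves-live = successor-preserves-live
    ; injective-on-live = successor-injective-on-live
    ; surjective-on-live = successor-surjective-on-live
    }

  cosuccessor : ℤ → ℤ
  cosuccessor L = if a (L + n + n - + 2) then L + n + n - + 2 else L + n + n - 1ℤ

  cosuccessor-of-live : ∀ L → a (L + n + n - + 2) ≡ true → cosuccessor L ≡ L + n + n - + 2
  cosuccessor-of-live L live rewrite live = refl

  cosuccessor-of-dead : ∀ L → a (L + n + n - + 2) ≡ false → cosuccessor L ≡ L + n + n - 1ℤ
  cosuccessor-of-dead L dead rewrite dead = refl

  cosuccessor-preserves-live : ∀ {L} → a L ≡ true → a (cosuccessor L) ≡ true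
  cosuccessor-preserves-live {L} live with a (L + n + n - + 2) in left₂
  ... | true = left₂
  ... | false = trans (recurrence-at (L + n - 1ℤ) (eq₁ L n) (eq₂ L n) (eq₃ L n))
                      (toggleRule≡true⇐ (live⇒dead-below-left live) left₂ (live⇒dead-below live))
    where
    eq₁ : ∀ L n → L + n + n - 1ℤ ≡ L + n - 1ℤ + n
    eq₁ = solve-∀
    eq₂ : ∀ L n → L + n + n - + 2 ≡ L + n - 1ℤ + n - 1ℤ
    eq₂ = solve-∀
    eq₃ : ∀ L n → L + n ≡ L + n - 1ℤ + 1ℤ
    eq₃ = solve-∀

  cosuccessor-injective-on-live : ∀ {L L'} → a L ≡ true → a L' ≡ true →
    cosuccessor L ≡ cosuccessor L' → L ≡ L'
  cosuccessor-injective-on-live {L} {L'} live live' eq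
    with a (L + n + n - + 2) | a (L' + n + n - + 2)
  ... | true | true = +-cancelʳ n (+-cancelʳ n (+-cancelʳ (- + 2) eq))
  ... | false | false = +-cancelʳ n (+-cancelʳ n (+-cancelʳ (- 1ℤ) eq))
  ... | true | false = ⊥-elim (true-and-false (subst (λ M → a M ≡ true) (+2n-2≡+2n-1⇒ L L' eq) live)
                                                (live⇒dead-right {L'} live'))
  ... | false | true = ⊥-elim (true-and-false (subst (λ M → a M ≡ true) (+2n-2≡+2n-1⇒ L' L (sym eq)) live')
                                                (live⇒dead-right {L} live))

  -- M kills M - n + 1, so by the recurrence one of K, K + 1 is live, where K = M - 2n + 1.
  cosuccessor-surjective-on-live : ∀ {M} → a M ≡ true → Σ ℤ λ L → a L ≡ true × cosuccessor L ≡ M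
  cosuccessor-surjective-on-live {M} live = preimage (toggleRule≡false⇒ _ _ _ up-right-rule)
    where
    above-dead = live⇒dead-above live
    K = M - n + 1ℤ - n
    eq₁ : ∀ M n → M - n + 1ℤ ≡ M - n + 1ℤ - n + n
    eq₁ = solve-∀
    eq₂ : ∀ M n → M - n ≡ M - n + 1ℤ - n + n - 1ℤ
    eq₂ = solve-∀
    eq₃ : ∀ M n → M - 1ℤ ≡ M - n + 1ℤ - n + n + n - + 2
    eq₃ = solve-∀
    eq₄ : ∀ M n → M - n + 1ℤ - n + n + n - 1ℤ ≡ M
    eq₄ = solve-∀
    eq₅ : ∀ M n → M - n + 1ℤ - n + 1ℤ + n + n - + 2 ≡ M
    eq₅ = solve-∀
    up-right-rule : toggleRule (a K) (a (M - n)) (a (K + 1ℤ)) ≡ false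
    up-right-rule = trans (sym (recurrence-at K (eq₁ M n) (eq₂ M n) refl))
                          (proj₂ (proj₂ above-dead))
    preimage : a K ≡ true ⊎ a (M - n) ≡ true ⊎ a (K + 1ℤ) ≡ true →
      Σ ℤ λ L → a L ≡ true × cosuccessor L ≡ M
    preimage (inj₁ K-live) = K , K-live ,
      trans (cosuccessor-of-dead K
               (subst (λ J → a J ≡ false) (eq₃ M n) (proj₁ (proj₂ above-dead))))
            (eq₄ M n)
    preimage (inj₂ (inj₁ up)) = ⊥-elim (true-and-false up (proj₁ above-dead))
    preimage (inj₂ (inj₂ K+1-live)) = K + 1ℤ , K+1-live ,
      trans (cosuccessor-of-live (K + 1ℤ) (subst (λ J → a J ≡ true) (sym (eq₅ M n)) live)) (eq₅ M n)

  cosuccessor-permutesLive : PermutesLive a cosuccessor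
  cosuccessor-permutesLive = record
    { preserves-live = cosuccessor-preserves-live
    ; injective-on-live = cosuccessor-injective-on-live
    ; surjective-on-live = cosuccessor-surjective-on-live
    }

module Cycle (m : ℕ) where

  N : ℕ
  N = suc (suc m)

  vertex : ℕ → Fin N
  vertex s = fromℕ< (m%n<n s N)

  toℕ-vertex : ∀ {s} → s < N → toℕ (vertex s) ≡ s
  toℕ-vertex {s} s<N = trans (Fin.toℕ-fromℕ< (m%n<n s N)) (m<n⇒m%n≡m s<N)

  vertex-toℕ : ∀ (k : Fin N) → vertex (toℕ k) ≡ k
  vertex-toℕ k = Fin.toℕ-injective (toℕ-vertex (Fin.toℕ<n k))

  toℕ-nextV : ∀ (k : Fin N) → suc (toℕ k) < N → toℕ (nextV k) ≡ suc (toℕ k)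
  toℕ-nextV k = toℕ-vertex

  toℕ-nextV-last : ∀ (k : Fin N) → toℕ k ≡ suc m → toℕ (nextV k) ≡ 0
  toℕ-nextV-last k last = trans (Fin.toℕ-fromℕ< (m%n<n (suc (toℕ k)) N))
                                (trans (%-congˡ {o = N} (cong suc last)) (n%n≡0 N))

  toℕ-prevV : ∀ (k : Fin N) {j} → toℕ k ≡ suc j → toℕ (prevV k) ≡ j
  toℕ-prevV k {j} k≡1+j = begin
    toℕ (prevV k)         ≡⟨ Fin.toℕ-fromℕ< (m%n<n (toℕ k ℕ.+ suc m) N) ⟩
    (toℕ k ℕ.+ suc m) % N ≡⟨ %-congˡ {o = N} (trans (cong (ℕ._+ suc m) k≡1+j) (sym (ℕ.+-suc j (suc m)))) ⟩
    (j ℕ.+ N) % N         ≡⟨ [m+n]%n≡m%n j N ⟩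
    j % N                 ≡⟨ m<n⇒m%n≡m j<N ⟩
    j                     ∎
    where
    open ≡-Reasoning
    j<N : j < N
    j<N = ℕ.<-trans (subst (j <_) (sym k≡1+j) (ℕ.n<1+n j)) (Fin.toℕ<n k)

  toℕ-prevV-first : ∀ (k : Fin N) → toℕ k ≡ 0 → toℕ (prevV k) ≡ suc m
  toℕ-prevV-first k first = trans (Fin.toℕ-fromℕ< (m%n<n (toℕ k ℕ.+ suc m) N))
    (trans (%-congˡ {o = N} (cong (ℕ._+ suc m) first)) (m<n⇒m%n≡m (ℕ.n<1+n (suc m))))

  data LastView (k : Fin N) : Set where
    last : toℕ k ≡ suc m → LastView k
    notLast : suc (toℕ k) < N → LastView k

  lastView : ∀ (k : Fin N) → LastView k
  lastView k with ℕ.m≤n⇒m<n∨m≡n (s≤s⁻¹ (Fin.toℕ<n k))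
  ... | inj₁ k<1+m = notLast (s≤s k<1+m)
  ... | inj₂ k≡1+m = last k≡1+m

  data FirstView (k : Fin N) : Set where
    first : toℕ k ≡ 0 → FirstView k
    notFirst : ∀ j → toℕ k ≡ suc j → FirstView k

  firstView : ∀ (k : Fin N) → FirstView k
  firstView k with toℕ k in eq
  ... | zero = first eq
  ... | suc j = notFirst j eq

  nextV≢ : ∀ (k : Fin N) → nextV k ≢ k
  nextV≢ k eq with lastView k
  ... | last k≡1+m = ℕ.0≢1+n (trans (sym (toℕ-nextV-last k k≡1+m)) (trans (cong toℕ eq) k≡1+m))
  ... | notLast lt = ℕ.<⇒≢ (ℕ.n<1+n (toℕ k)) (trans (sym (cong toℕ eq)) (toℕ-nextV k lt))

  prevV≢ : ∀ (k : Fin N) → prevV k ≢ k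
  prevV≢ k eq with firstView k
  ... | first k≡0 = ℕ.0≢1+n (trans (sym k≡0) (trans (sym (cong toℕ eq)) (toℕ-prevV-first k k≡0)))
  ... | notFirst j k≡1+j =
    ℕ.<⇒≢ (ℕ.n<1+n j) (trans (sym (toℕ-prevV k k≡1+j)) (trans (cong toℕ eq) k≡1+j))

  nextV-prevV : ∀ (k : Fin N) → nextV (prevV k) ≡ k
  nextV-prevV k with firstView k
  ... | first k≡0 =
    Fin.toℕ-injective (trans (toℕ-nextV-last (prevV k) (toℕ-prevV-first k k≡0)) (sym k≡0))
  ... | notFirst j k≡1+j =
    Fin.toℕ-injective
      (trans (toℕ-nextV (prevV k) lt) (trans (cong suc (toℕ-prevV k k≡1+j)) (sym k≡1+j)))
    where
    lt : suc (toℕ (prevV k)) < N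
    lt = subst (λ i → suc i < N) (sym (toℕ-prevV k k≡1+j)) (subst (_< N) k≡1+j (Fin.toℕ<n k))

  prevV-nextV : ∀ (k : Fin N) → prevV (nextV k) ≡ k
  prevV-nextV k with lastView k
  ... | last k≡1+m =
    Fin.toℕ-injective (trans (toℕ-prevV-first (nextV k) (toℕ-nextV-last k k≡1+m)) (sym k≡1+m))
  ... | notLast lt = Fin.toℕ-injective (toℕ-prevV (nextV k) (toℕ-nextV k lt))

module Toggling (m : ℕ) where
  open Cycle m

  toggle-at-self : ∀ (k : Fin N) (y : Config N) →
    toggle k y k ≡ toggleRule (y k) (y (prevV k)) (y (nextV k))
  toggle-at-self k y rewrite dec-true (k ≟ k) refl = refl

  toggle-elsewhere : ∀ (k l : Fin N) (y : Config N) → l ≢ k → toggle k y l ≡ y l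
  toggle-elsewhere k l y l≢k rewrite dec-false (l ≟ k) l≢k = refl

  toggle-cong : ∀ (k : Fin N) {y y' : Config N} → (∀ v → y v ≡ y' v) →
    ∀ l → toggle k y l ≡ toggle k y' l
  toggle-cong k y≈y' l rewrite y≈y' k | y≈y' (prevV k) | y≈y' (nextV k) | y≈y' l = refl

  toggle-preserves-Independent : ∀ (k : Fin N) (y : Config N) →
    Independent y → Independent (toggle k y)
  toggle-preserves-Independent k y ind v (v-live , next-live) = by-cases (v ≟ k) (nextV v ≟ k)
    where
    dead-around-k : toggle k y k ≡ true → y k ≡ false × y (prevV k) ≡ false × y (nextV k) ≡ false
    dead-around-k k-live = toggleRule≡true⇒ _ _ _ (trans (sym (toggle-at-self k y)) k-live)

    by-cases : Dec (v ≡ k) → Dec (nextV v ≡ k) → ⊥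
    by-cases (yes v≡k) _ = true-and-false
      (trans (sym (toggle-elsewhere k (nextV k) y (nextV≢ k)))
             (subst (λ u → toggle k y (nextV u) ≡ true) v≡k next-live))
      (proj₂ (proj₂ (dead-around-k (subst (λ u → toggle k y u ≡ true) v≡k v-live))))
    by-cases (no v≢k) (yes next≡k) = true-and-false
      (trans (cong y (trans (sym (cong prevV next≡k)) (prevV-nextV v)))
             (trans (sym (toggle-elsewhere k v y v≢k)) v-live))
      (proj₁ (proj₂ (dead-around-k (subst (λ u → toggle k y u ≡ true) next≡k next-live))))
    by-cases (no v≢k) (no next≢k) = ind v
      ( trans (sym (toggle-elsewhere k v y v≢k)) v-live
      , trans (sym (toggle-elsewhere k (nextV v) y next≢k)) next-live)

  Independent⇒next-dead : ∀ {y : Config N} → Independent y → ∀ k → y k ≡ true → y (nextV k) ≡ false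
  Independent⇒next-dead {y} ind k k-live with y (nextV k) in next
  ... | false = refl
  ... | true = ⊥-elim (ind k (k-live , next))

  Independent⇒prev-dead : ∀ {y : Config N} → Independent y → ∀ k → y k ≡ true → y (prevV k) ≡ false
  Independent⇒prev-dead {y} ind k k-live with y (prevV k) in prev
  ... | false = refl
  ... | true = ⊥-elim (ind (prevV k) (prev , trans (cong y (nextV-prevV k)) k-live))

  toggle-involutive : ∀ (k : Fin N) (y : Config N) → Independent y →
    ∀ l → toggle k (toggle k y) l ≡ y l
  toggle-involutive k y ind l = by-cases (l ≟ k)
    where
    open ≡-Reasoning
    at-k : toggle k (toggle k y) k ≡ y k
    at-k = begin
      toggle k (toggle k y) k
        ≡⟨ toggle-at-self k (toggle k y) ⟩
      toggleRule (toggle k y k) (toggle k y (prevV k)) (toggle k y (nextV k))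
        ≡⟨ toggleRule-cong (toggle-at-self k y) (toggle-elsewhere k (prevV k) y (prevV≢ k))
                                                (toggle-elsewhere k (nextV k) y (nextV≢ k)) ⟩
      toggleRule (toggleRule (y k) (y (prevV k)) (y (nextV k))) (y (prevV k)) (y (nextV k))
        ≡⟨ toggleRule-involutive _ _ _ (λ k-live →
             Independent⇒prev-dead ind k k-live , Independent⇒next-dead ind k k-live) ⟩
      y k ∎

    by-cases : Dec (l ≡ k) → toggle k (toggle k y) l ≡ y l
    by-cases (yes l≡k) = subst (λ u → toggle k (toggle k y) u ≡ y u) (sym l≡k) at-k
    by-cases (no l≢k) = trans (toggle-elsewhere k l (toggle k y) l≢k) (toggle-elsewhere k l y l≢k)

  sweep : ℕ → Config N → Config N
  sweep zero y = y
  sweep (suc s) y = toggle (vertex s) (sweep s y)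

  reverse-sweep-preserves-Independent : ∀ s y → Independent y → Independent (toggles (λ j → j) s y)
  reverse-sweep-preserves-Independent zero y ind = ind
  reverse-sweep-preserves-Independent (suc s) y ind =
    reverse-sweep-preserves-Independent s (toggle (vertex s) y)
      (toggle-preserves-Independent (vertex s) y ind)

  sweep-reverse-sweep : ∀ s y → Independent y → ∀ v → sweep s (toggles (λ j → j) s y) v ≡ y v
  sweep-reverse-sweep zero y ind v = refl
  sweep-reverse-sweep (suc s) y ind v =
    trans (toggle-cong (vertex s) (sweep-reverse-sweep s (toggle (vertex s) y) toggled-ind) v)
          (toggle-involutive (vertex s) y ind v)
    where
    toggled-ind = toggle-preserves-Independent (vertex s) y ind

  tau≡sweep : ∀ y → tau y ≡ sweep N y
  tau≡sweep y = remaining N 0 refl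
    where
    remaining : ∀ r s → s ℕ.+ r ≡ N → toggles (λ j → suc m ∸ j) r (sweep s y) ≡ sweep N y
    remaining zero s s+0≡N = cong (λ t → sweep t y) (trans (sym (ℕ.+-identityʳ s)) s+0≡N)
    remaining (suc r) s s+1+r≡N =
      trans (cong (λ t → toggles (λ j → suc m ∸ j) r (toggle (vertex t) (sweep s y))) next-vertex)
            (remaining r (suc s) (trans (sym (ℕ.+-suc s r)) s+1+r≡N))
      where
      next-vertex : suc m ∸ r ≡ s
      next-vertex = trans (cong (_∸ r) (sym (ℕ.suc-injective (trans (sym (ℕ.+-suc s r)) s+1+r≡N))))
                          (ℕ.m+n∸n≡m s r)

  tau-tauInv : ∀ y → Independent y → ∀ v → tau (tauInv y) v ≡ y v
  tau-tauInv y ind v =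
    trans (cong (λ f → f v) (tau≡sweep (tauInv y))) (sweep-reverse-sweep N y ind v)

  tauInv-preserves-Independent : ∀ y → Independent y → Independent (tauInv y)
  tauInv-preserves-Independent = reverse-sweep-preserves-Independent N

  sweep-step-elsewhere : ∀ s y (v : Fin N) → s < N → toℕ v ≢ s → sweep (suc s) y v ≡ sweep s y v
  sweep-step-elsewhere s y v s<N v≢s =
    toggle-elsewhere (vertex s) v (sweep s y) (λ v≡ → v≢s (trans (cong toℕ v≡) (toℕ-vertex s<N)))

  sweep-untouched : ∀ t y (v : Fin N) → t ≤ toℕ v → sweep t y v ≡ y v
  sweep-untouched zero y v _ = refl
  sweep-untouched (suc t) y v t<v =
    trans (sweep-step-elsewhere t y v (ℕ.<-≤-trans t<v (ℕ.<⇒≤ (Fin.toℕ<n v))) (ℕ.>⇒≢ t<v))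
          (sweep-untouched t y v (ℕ.<⇒≤ t<v))

  sweep-settled : ∀ d t y (v : Fin N) → toℕ v < t → d ℕ.+ t ≤ N → sweep (d ℕ.+ t) y v ≡ sweep t y v
  sweep-settled zero t y v _ _ = refl
  sweep-settled (suc d) t y v v<t d+t<N =
    trans (sweep-step-elsewhere (d ℕ.+ t) y v d+t<N (ℕ.<⇒≢ (ℕ.<-≤-trans v<t (ℕ.m≤n+m t d))))
          (sweep-settled d t y v v<t (ℕ.<⇒≤ d+t<N))

  sweep-settled-tau : ∀ t y (v : Fin N) → toℕ v < t → t ≤ N → sweep t y v ≡ tau y v
  sweep-settled-tau t y v v<t t≤N = begin
    sweep t y v             ≡⟨ sweep-settled (N ∸ t) t y v v<t (ℕ.≤-reflexive (ℕ.m∸n+n≡m t≤N)) ⟨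
    sweep (N ∸ t ℕ.+ t) y v ≡⟨ cong (λ s → sweep s y v) (ℕ.m∸n+n≡m t≤N) ⟩
    sweep N y v             ≡⟨ cong (λ f → f v) (tau≡sweep y) ⟨
    tau y v                 ∎
    where open ≡-Reasoning

  tau-at : ∀ y (k : Fin N) →
    tau y k ≡ toggleRule (y k) (sweep (toℕ k) y (prevV k)) (sweep (toℕ k) y (nextV k))
  tau-at y k = begin
    tau y k                         ≡⟨ sweep-settled-tau (suc (toℕ k)) y k (ℕ.n<1+n _) (Fin.toℕ<n k) ⟨
    toggle (vertex (toℕ k)) swept k ≡⟨ cong (λ u → toggle u swept k) (vertex-toℕ k) ⟩
    toggle k swept k                ≡⟨ toggle-at-self k swept ⟩
    toggleRule (swept k) left right ≡⟨ cong (λ b → toggleRule b left right) untouched ⟩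
    toggleRule (y k) left right     ∎
    where
    open ≡-Reasoning
    swept = sweep (toℕ k) y
    left = swept (prevV k)
    right = swept (nextV k)
    untouched = sweep-untouched (toℕ k) y k ℕ.≤-refl

  sweep-prevV-first : ∀ y (k : Fin N) → toℕ k ≡ 0 → sweep (toℕ k) y (prevV k) ≡ y (prevV k)
  sweep-prevV-first y k k≡0 =
    sweep-untouched (toℕ k) y (prevV k) (subst (_≤ toℕ (prevV k)) (sym k≡0) z≤n)

  sweep-prevV : ∀ y (k : Fin N) {j} → toℕ k ≡ suc j → sweep (toℕ k) y (prevV k) ≡ tau y (prevV k)
  sweep-prevV y k {j} k≡1+j = sweep-settled-tau (toℕ k) y (prevV k)
    (subst₂ _<_ (sym (toℕ-prevV k k≡1+j)) (sym k≡1+j) (ℕ.n<1+n j)) (ℕ.<⇒≤ (Fin.toℕ<n k))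

  sweep-nextV-last : ∀ y (k : Fin N) → toℕ k ≡ suc m → sweep (toℕ k) y (nextV k) ≡ tau y (nextV k)
  sweep-nextV-last y k k≡1+m = sweep-settled-tau (toℕ k) y (nextV k)
    (subst₂ _<_ (sym (toℕ-nextV-last k k≡1+m)) (sym k≡1+m) (s≤s z≤n)) (ℕ.<⇒≤ (Fin.toℕ<n k))

  sweep-nextV : ∀ y (k : Fin N) → suc (toℕ k) < N → sweep (toℕ k) y (nextV k) ≡ y (nextV k)
  sweep-nextV y k lt =
    sweep-untouched (toℕ k) y (nextV k) (subst (toℕ k ≤_) (sym (toℕ-nextV k lt)) (ℕ.n≤1+n _))

module Linearization (N : ℕ) .{{_ : NonZero N}} where

  index : Pos N → ℤ
  index (i , k) = i * + N + + toℕ k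

  position : ℤ → Pos N
  position L = L /ℕ N , fromℕ< (n%ℕd<d L N)

  index-position : ∀ L → index (position L) ≡ L
  index-position L = begin
    L /ℕ N * + N + + toℕ (fromℕ< (n%ℕd<d L N))
      ≡⟨ cong (λ r → L /ℕ N * + N + + r) (Fin.toℕ-fromℕ< (n%ℕd<d L N)) ⟩
    L /ℕ N * + N + + (L %ℕ N)
      ≡⟨ ℤ.+-comm (L /ℕ N * + N) (+ (L %ℕ N)) ⟩
    + (L %ℕ N) + L /ℕ N * + N
      ≡⟨ a≡a%ℕn+[a/ℕn]*n L N ⟨
    L ∎
    where open ≡-Reasoning

  /ℕ-unique : ∀ q {r} → r < N → (q * + N + + r) /ℕ N ≡ q
  /ℕ-unique q {r} r<N = ℤ.≤-antisym Q≤q q≤Q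
    where
    L = q * + N + + r
    Q = L /ℕ N
    <1+⇒≤ : ∀ {i j} → i ℤ.< 1ℤ + j → i ℤ.≤ j
    <1+⇒≤ {j = j} i<1+j = subst (_ ℤ.≤_) (ℤ.pred-suc j) (ℤ.i<j⇒i≤pred[j] i<1+j)
    1+x*N : ∀ x N → x * N + N ≡ (1ℤ + x) * N
    1+x*N = solve-∀
    L<[1+q]*N : L ℤ.< (1ℤ + q) * + N
    L<[1+q]*N = subst (L ℤ.<_) (1+x*N q (+ N)) (ℤ.+-monoʳ-< (q * + N) (+<+ r<N))
    Q≤q : Q ℤ.≤ q
    Q≤q = <1+⇒≤ (ℤ.*-cancelʳ-<-nonNeg (+ N) (ℤ.≤-<-trans ([n/ℕd]*d≤n L N) L<[1+q]*N))
    q≤Q : q ℤ.≤ Q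
    q≤Q = <1+⇒≤ (ℤ.*-cancelʳ-<-nonNeg (+ N)
                   (ℤ.≤-<-trans (ℤ.i≤i+j (q * + N) (+ r)) (n<s[n/ℕd]*d L N)))

  %ℕ-unique : ∀ q {r} → r < N → (q * + N + + r) %ℕ N ≡ r
  %ℕ-unique q {r} r<N = sym (ℤ.+-injective (+-cancelʳ (q * + N) (begin
    + r + q * + N                 ≡⟨ ℤ.+-comm (+ r) (q * + N) ⟩
    L                             ≡⟨ a≡a%ℕn+[a/ℕn]*n L N ⟩
    + (L %ℕ N) + L /ℕ N * + N     ≡⟨ cong (λ d → + (L %ℕ N) + d * + N) (/ℕ-unique q r<N) ⟩
    + (L %ℕ N) + q * + N          ∎)))
    where
    open ≡-Reasoning
    L = q * + N + + r

  position-index : ∀ p → position (index p) ≡ p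
  position-index (i , k) = cong₂ _,_ (/ℕ-unique i (Fin.toℕ<n k))
    (Fin.toℕ-injective
      (trans (Fin.toℕ-fromℕ< (n%ℕd<d (index (i , k)) N)) (%ℕ-unique i (Fin.toℕ<n k))))

module Scroll (m : ℕ) (x : Config (suc (suc m))) (ind : Independent x) where
  open Cycle m
  open Toggling m
  open Linearization N

  n : ℤ
  n = + N

  a : ℤ → Bool
  a L = val x (position L)

  a-index : ∀ p → a (index p) ≡ val x p
  a-index p = cong (val x) (position-index p)

  tauInv-iterate-Independent : ∀ j → Independent (iterN tauInv j x)
  tauInv-iterate-Independent zero = ind
  tauInv-iterate-Independent (suc j) =
    tauInv-preserves-Independent _ (tauInv-iterate-Independent j)

  orbit-step : ∀ i k → orbit x (i + 1ℤ) k ≡ tau (orbit x i) k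
  orbit-step (+ j) k = cong (λ t → iterN tau t x k) (ℕ.+-comm j 1)
  orbit-step -[1+ zero ] k = sym (tau-tauInv x ind k)
  orbit-step -[1+ suc j ] k =
    sym (tau-tauInv (iterN tauInv (suc j) x) (tauInv-iterate-Independent (suc j)) k)

  index-next-row : ∀ i k → index (i + 1ℤ , k) ≡ index (i , k) + n
  index-next-row i k = shift i n (+ toℕ k)
    where
    shift : ∀ i n t → (i + 1ℤ) * n + t ≡ i * n + t + n
    shift = solve-∀

  -- After the rewrites, + suc m appears where n - 1ℤ is written: the two are definitionally equal.
  index-prevV-first : ∀ i k → toℕ k ≡ 0 → index (i , prevV k) ≡ index (i , k) + n - 1ℤ
  index-prevV-first i k k≡0 rewrite toℕ-prevV-first k k≡0 | k≡0 = shift i n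
    where
    shift : ∀ i n → i * n + (n - 1ℤ) ≡ i * n + + 0 + n - 1ℤ
    shift = solve-∀

  index-prevV : ∀ i k {j} → toℕ k ≡ suc j →
    index (i + 1ℤ , prevV k) ≡ index (i , k) + n - 1ℤ
  index-prevV i k {j} k≡1+j rewrite toℕ-prevV k k≡1+j | k≡1+j = shift i n (+ j)
    where
    shift : ∀ i n t → (i + 1ℤ) * n + t ≡ i * n + (1ℤ + t) + n - 1ℤ
    shift = solve-∀

  index-nextV-last : ∀ i k → toℕ k ≡ suc m →
    index (i + 1ℤ , nextV k) ≡ index (i , k) + 1ℤ
  index-nextV-last i k k≡1+m rewrite toℕ-nextV-last k k≡1+m | k≡1+m = shift i n
    where
    shift : ∀ i n → (i + 1ℤ) * n + + 0 ≡ i * n + (n - 1ℤ) + 1ℤ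
    shift = solve-∀

  index-nextV : ∀ i k → suc (toℕ k) < N → index (i , nextV k) ≡ index (i , k) + 1ℤ
  index-nextV i k lt rewrite toℕ-nextV k lt = shift i n (+ toℕ k)
    where
    shift : ∀ i n t → i * n + (1ℤ + t) ≡ i * n + t + 1ℤ
    shift = solve-∀

  left-neighbour : ∀ i k → sweep (toℕ k) (orbit x i) (prevV k) ≡ a (index (i , k) + n - 1ℤ)
  left-neighbour i k with firstView k
  ... | first k≡0 = begin
    sweep (toℕ k) (orbit x i) (prevV k) ≡⟨ sweep-prevV-first (orbit x i) k k≡0 ⟩
    orbit x i (prevV k)                 ≡⟨ a-index (i , prevV k) ⟨
    a (index (i , prevV k))             ≡⟨ cong a (index-prevV-first i k k≡0) ⟩
    a (index (i , k) + n - 1ℤ)          ∎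
    where open ≡-Reasoning
  ... | notFirst j k≡1+j = begin
    sweep (toℕ k) (orbit x i) (prevV k) ≡⟨ sweep-prevV (orbit x i) k k≡1+j ⟩
    tau (orbit x i) (prevV k)           ≡⟨ orbit-step i (prevV k) ⟨
    orbit x (i + 1ℤ) (prevV k)          ≡⟨ a-index (i + 1ℤ , prevV k) ⟨
    a (index (i + 1ℤ , prevV k))        ≡⟨ cong a (index-prevV i k k≡1+j) ⟩
    a (index (i , k) + n - 1ℤ)          ∎
    where open ≡-Reasoning

  right-neighbour : ∀ i k → sweep (toℕ k) (orbit x i) (nextV k) ≡ a (index (i , k) + 1ℤ)
  right-neighbour i k with lastView k
  ... | last k≡1+m = begin
    sweep (toℕ k) (orbit x i) (nextV k) ≡⟨ sweep-nextV-last (orbit x i) k k≡1+m ⟩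
    tau (orbit x i) (nextV k)           ≡⟨ orbit-step i (nextV k) ⟨
    orbit x (i + 1ℤ) (nextV k)          ≡⟨ a-index (i + 1ℤ , nextV k) ⟨
    a (index (i + 1ℤ , nextV k))        ≡⟨ cong a (index-nextV-last i k k≡1+m) ⟩
    a (index (i , k) + 1ℤ)              ∎
    where open ≡-Reasoning
  ... | notLast lt = begin
    sweep (toℕ k) (orbit x i) (nextV k) ≡⟨ sweep-nextV (orbit x i) k lt ⟩
    orbit x i (nextV k)                 ≡⟨ a-index (i , nextV k) ⟨
    a (index (i , nextV k))             ≡⟨ cong a (index-nextV i k lt) ⟩
    a (index (i , k) + 1ℤ)              ∎
    where open ≡-Reasoning

  scroll-recurrence : ∀ L → a (L + n) ≡ toggleRule (a L) (a (L + n - 1ℤ)) (a (L + 1ℤ))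
  scroll-recurrence L =
    subst (λ M → a (M + n) ≡ toggleRule (a M) (a (M + n - 1ℤ)) (a (M + 1ℤ)))
          (index-position L) (at-position (position L))
    where
    open ≡-Reasoning
    at-position : ∀ p →
      a (index p + n) ≡ toggleRule (a (index p)) (a (index p + n - 1ℤ)) (a (index p + 1ℤ))
    at-position (i , k) = begin
      a (index (i , k) + n)    ≡⟨ cong a (index-next-row i k) ⟨
      a (index (i + 1ℤ , k))   ≡⟨ a-index (i + 1ℤ , k) ⟩
      orbit x (i + 1ℤ) k       ≡⟨ orbit-step i k ⟩
      tau (orbit x i) k        ≡⟨ tau-at (orbit x i) k ⟩
      toggleRule (orbit x i k) (sweep (toℕ k) (orbit x i) (prevV k))
                               (sweep (toℕ k) (orbit x i) (nextV k))
        ≡⟨ toggleRule-cong (sym (a-index (i , k))) (left-neighbour i k) (right-neighbour i k) ⟩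
      toggleRule (a (index (i , k))) (a (index (i , k) + n - 1ℤ)) (a (index (i , k) + 1ℤ)) ∎

  open ToggleRecurrence a n scroll-recurrence

  -- norm N i j is definitionally position (i * n + (j - 1)), and col k is 1ℤ + + toℕ k.
  succ≡successor : ∀ p → succ N x p ≡ position (successor (index p))
  succ≡successor (i , k) = begin
    succ N x (i , k)
      ≡⟨ cong₂ (λ u v → if a u then position u else position v)
               (right₂ i n (+ toℕ k)) (down-right i n (+ toℕ k)) ⟩
    (if a (index (i , k) + + 2) then position (index (i , k) + + 2)
                                else position (index (i , k) + n + 1ℤ))
      ≡⟨ if-float position (a (index (i , k) + + 2)) ⟨
    position (successor (index (i , k)))  ∎
    where
    open ≡-Reasoning
    right₂ : ∀ i n t → i * n + (1ℤ + t + + 2 - + 1) ≡ i * n + t + + 2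
    right₂ = solve-∀
    down-right : ∀ i n t → (i + + 1) * n + (1ℤ + t + + 1 - + 1) ≡ i * n + t + n + 1ℤ
    down-right = solve-∀

  cosucc≡cosuccessor : ∀ p → cosucc N x p ≡ position (cosuccessor (index p))
  cosucc≡cosuccessor (i , k) = begin
    cosucc N x (i , k)
      ≡⟨ cong₂ (λ u v → if a u then position u else position v)
               (left₂ i n (+ toℕ k)) (left i n (+ toℕ k)) ⟩
    (if a (index (i , k) + n + n - + 2) then position (index (i , k) + n + n - + 2)
                                         else position (index (i , k) + n + n - 1ℤ))
      ≡⟨ if-float position (a (index (i , k) + n + n - + 2)) ⟨
    position (cosuccessor (index (i , k)))  ∎
    where
    open ≡-Reasoning
    left₂ : ∀ i n t → (i + + 2) * n + (1ℤ + t - + 2 - + 1) ≡ i * n + t + n + n - + 2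
    left₂ = solve-∀
    left : ∀ i n t → (i + + 2) * n + (1ℤ + t - + 1 - + 1) ≡ i * n + t + n + n - 1ℤ
    left = solve-∀

  succ-permutesLive : PermutesLive (val x) (succ N x)
  succ-permutesLive =
    permutesLive-transport position index position-index index-position
      succ≡successor successor-permutesLive

  cosucc-permutesLive : PermutesLive (val x) (cosucc N x)
  cosucc-permutesLive =
    permutesLive-transport position index position-index index-position
      cosucc≡cosuccessor cosuccessor-permutesLive

lemma2p4 : ∀ (n : ℕ) .{{_ : NonZero n}} → 2 ≤ n → (x : Config n) → Independent x →
    (Σ (Live n x → Live n x) λ f → (∀ q → proj₁ (f q) ≡ succ n x (proj₁ q)) × Bijective _≡_ _≡_ f)
    × (Σ (Live n x → Live n x) λ f → (∀ q → proj₁ (f q) ≡ cosucc n x (proj₁ q)) × Bijective _≡_ _≡_ f)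
lemma2p4 (suc (suc m)) (s≤s (s≤s _)) x ind =
  permutesLive-restricts succ-permutesLive , permutesLive-restricts cosucc-permutesLive
  where open Scroll m x ind
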